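{- Let $k$, $n$ and $s$ be positive integers and let $x_1,\ldots,x_n$ be independent variables. Then $$H_k^{(s-1)}(x_1,\ldots,x_n)=\sum_{j=0}^{\lfloor k/s\rfloor}(-1)^{sj}h_j(x_1^s,\ldots,x_n^s)\,e_{k-sj}(x_1,\ldots,x_n)$$ and $$E_k^{(s-1)}(x_1,\ldots,x_n)=\sum_{j=0}^{\lfloor k/s\rfloor}(-1)^{j}e_j(x_1^s,\ldots,x_n^s)\,h_{k-sj}(x_1,\ldots,x_n).$$
   Context: For a nonnegative integer $r$, $H_k^{(r)}$ and $E_k^{(r)}$ ($k\ge0$) are defined by the formal power series identities $$\sum_{k\ge0}H_k^{(r)}(x_1,\ldots,x_n)t^k=\prod_{i=1}^n\big(1-x_it+\cdots+(-x_it)^r\big)^{ -1},\qquad \sum_{k\ge0}E_k^{(r)}(x_1,\ldots,x_n)t^k=\prod_{i=1}^n\big(1+x_it+\cdots+(x_it)^r\big)$$ (for $r=0$ each factor equals $1$). $h_j$ and $e_j$ denote the complete homogeneous and elementary symmetric functions. -}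

module Defs where

open import Algebra.Bundles using (CommutativeRing)
open import Data.Nat as ℕ using (ℕ; zero; suc; _∸_)
open import Data.Fin using (Fin; zero; suc)
open import Data.Bool using (if_then_else_)
open import Relation.Nullary.Decidable using (does)
open import Function using (_∘_)

module Sym {c ℓ} (R : CommutativeRing c ℓ) where
  open CommutativeRing R hiding (zero)

  Series : Set c
  Series = ℕ → Carrier

  pow : Carrier → ℕ → Carrier
  pow x zero = 1#
  pow x (suc m) = x * pow x m

  Σ< : ℕ → (ℕ → Carrier) → Carrier
  Σ< zero f = 0#
  Σ< (suc n) f = Σ< n f + f n

  Σ≤ : ℕ → (ℕ → Carrier) → Carrier
  Σ≤ k f = Σ< (suc k) f

  mulS : Series → Series → Series
  mulS a b k = Σ≤ k (λ m → a m * b (k ∸ m))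

  oneS : Series
  oneS zero = 1#
  oneS (suc _) = 0#

  -- Multiplicative inverse of a series a with a 0 = 1:
  -- b 0 = 1,  b (k+1) = - Σ_{i=1}^{k+1} a i * b (k+1-i).
  -- invUpTo a k agrees with the inverse on all indices ≤ k.
  invUpTo : Series → ℕ → Series
  invUpTo a zero _ = 1#
  invUpTo a (suc k) m =
    if does (m ℕ.≤? k) then invUpTo a k m
    else - Σ< (suc k) (λ j → a (suc j) * invUpTo a k (k ∸ j))

  invS : Series → Series
  invS a k = invUpTo a k k

  prodS : ∀ {n} → (Fin n → Series) → Series
  prodS {zero} f = oneS
  prodS {suc n} f = mulS (f zero) (prodS (f ∘ suc))

  truncGeom : Carrier → ℕ → Series
  truncGeom y r m = if does (m ℕ.≤? r) then pow y m else 0#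

  Hr : ℕ → ∀ {n} → (Fin n → Carrier) → ℕ → Carrier
  Hr r x = prodS (λ i → invS (truncGeom (- x i) r))

  Er : ℕ → ∀ {n} → (Fin n → Carrier) → ℕ → Carrier
  Er r x = prodS (λ i → truncGeom (x i) r)

  -- elementary symmetric function e_j(x_1..x_n): sum over j-subsets,
  -- enumerated by whether x_1 is included
  esym : ∀ {n} → ℕ → (Fin n → Carrier) → Carrier
  esym {zero} zero x = 1#
  esym {zero} (suc j) x = 0#
  esym {suc n} zero x = 1#
  esym {suc n} (suc j) x = esym (suc j) (x ∘ suc) + x zero * esym j (x ∘ suc)

  -- complete homogeneous symmetric function h_j(x_1..x_n): sum over degree-j
  -- monomials, enumerated by the exponent m of x_1
  hsym : ∀ {n} → ℕ → (Fin n → Carrier) → Carrier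
  hsym {zero} zero x = 1#
  hsym {zero} (suc j) x = 0#
  hsym {suc n} j x = Σ≤ j (λ m → pow (x zero) m * hsym (j ∸ m) (x ∘ suc))

  powVars : ℕ → ∀ {n} → (Fin n → Carrier) → Fin n → Carrier
  powVars s x i = pow (x i) s

-- Work with generating functions in t. Since (1 + yt + ⋯ + (yt)^(s-1))(1 - yt) = 1 - (yt)^s,
-- every factor of the product defining E^(s-1) is (1 - y^s t^s)(1 - yt)^(-1), and every factor
-- defining H^(s-1) is (1 + xt)(1 - (-x)^s t^s)^(-1). Multiplying out, ∏(1 + x_i t) = Σ e_j t^j and
-- ∏(1 - x_i t)^(-1) = Σ h_j t^j; as the substitution t ↦ t^s is multiplicative, the factors in
-- t^s multiply to Σ (-1)^j e_j(x^s) t^(sj), resp. Σ (-1)^(sj) h_j(x^s) t^(sj), and comparing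
-- coefficients of t^k gives both identities.
module Submission where

open import Defs
open import Algebra.Bundles using (CommutativeRing; CommutativeMonoid)
open import Data.Nat as ℕ using (ℕ; zero; suc; _∸_; _≤_; _<_; z≤n; s≤s; NonZero)
import Data.Nat.Properties as ℕ
open import Data.Nat.DivMod using (_/_; _%_; m≡m%n+[m/n]*n; m%n<n; m*n/n≡m; m*n%n≡0; [m+kn]%n≡m%n; m<n⇒m%n≡m)
open import Data.Fin using (Fin; zero; suc)
open import Data.Product using (_×_; _,_)
open import Data.Sum using (inj₁; inj₂)
open import Data.Bool using (true; false; if_then_else_)
open import Function using (_∘_)
open import Relation.Nullary.Decidable using (does; dec-true; dec-false)
open import Relation.Binary.PropositionalEquality as ≡ using (_≡_)
import Algebra.Properties.CommutativeSemigroup as CommutativeSemigroupProperties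
import Algebra.Properties.Monoid as MonoidProperties
import Relation.Binary.Reasoning.Setoid as SetoidReasoning

module PowerSeries {c ℓ} (R : CommutativeRing c ℓ) where
  open CommutativeRing R hiding (zero)
  open Sym R
  open import Algebra.Properties.CommutativeSemiring.Exp commutativeSemiring
    using (_^_; ^-congˡ; ^-homo-*; ^-assocʳ; ^-distrib-*)
  open import Algebra.Properties.Ring ring using (-1*x≈-x; -‿involutive; -‿distribˡ-*)
  open CommutativeSemigroupProperties *-commutativeSemigroup using () renaming (interchange to *-interchange)
  open CommutativeSemigroupProperties +-commutativeSemigroup using () renaming (interchange to +-interchange)
  module ≈-Reasoning = SetoidReasoning setoid

  pow≡^ : ∀ x m → pow x m ≡ x ^ m
  pow≡^ x zero = ≡.refl
  pow≡^ x (suc m) = ≡.cong (x *_) (pow≡^ x m)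

  pow-cong : ∀ m {x y} → x ≈ y → pow x m ≈ pow y m
  pow-cong m {x} {y} x≈y rewrite pow≡^ x m | pow≡^ y m = ^-congˡ m x≈y

  pow-+ : ∀ x m n → pow x (m ℕ.+ n) ≈ pow x m * pow x n
  pow-+ x m n rewrite pow≡^ x (m ℕ.+ n) | pow≡^ x m | pow≡^ x n = ^-homo-* x m n

  pow-split : ∀ x {m k} → m ≤ k → pow x k ≈ pow x m * pow x (k ∸ m)
  pow-split x {m} {k} m≤k = trans (reflexive (≡.cong (pow x) (≡.sym (ℕ.m+[n∸m]≡n m≤k)))) (pow-+ x m (k ∸ m))

  pow-* : ∀ x m n → pow x (m ℕ.* n) ≈ pow (pow x m) n
  pow-* x m n rewrite pow≡^ x (m ℕ.* n) | pow≡^ (pow x m) n | pow≡^ x m = sym (^-assocʳ x m n)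

  pow-distrib-* : ∀ x y m → pow (x * y) m ≈ pow x m * pow y m
  pow-distrib-* x y m rewrite pow≡^ (x * y) m | pow≡^ x m | pow≡^ y m = ^-distrib-* x y m

  -- Finite sums

  Σ<-cong-< : ∀ n {f g : ℕ → Carrier} → (∀ i → i < n → f i ≈ g i) → Σ< n f ≈ Σ< n g
  Σ<-cong-< zero f≈g = refl
  Σ<-cong-< (suc n) f≈g = +-cong (Σ<-cong-< n (λ i i<n → f≈g i (ℕ.m<n⇒m<1+n i<n))) (f≈g n ℕ.≤-refl)

  Σ<-cong : ∀ n {f g : ℕ → Carrier} → (∀ i → f i ≈ g i) → Σ< n f ≈ Σ< n g
  Σ<-cong n f≈g = Σ<-cong-< n (λ i _ → f≈g i)

  Σ<-zero : ∀ n {f : ℕ → Carrier} → (∀ i → i < n → f i ≈ 0#) → Σ< n f ≈ 0#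
  Σ<-zero n {f} f≈0 = trans (Σ<-cong-< n f≈0) (Σ<-zero′ n)
    where
    Σ<-zero′ : ∀ n → Σ< n (λ _ → 0#) ≈ 0#
    Σ<-zero′ zero = refl
    Σ<-zero′ (suc n) = trans (+-identityʳ _) (Σ<-zero′ n)

  Σ<-head : ∀ n (f : ℕ → Carrier) → Σ< (suc n) f ≈ f 0 + Σ< n (f ∘ suc)
  Σ<-head zero f = trans (+-identityˡ _) (sym (+-identityʳ _))
  Σ<-head (suc n) f = trans (+-congʳ (Σ<-head n f)) (+-assoc _ _ _)

  Σ<-head-only : ∀ n {f : ℕ → Carrier} → (∀ i → i < n → f (suc i) ≈ 0#) → Σ< (suc n) f ≈ f 0
  Σ<-head-only n {f} f≈0 = trans (Σ<-head n f) (trans (+-congˡ (Σ<-zero n f≈0)) (+-identityʳ _))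

  Σ<-+ : ∀ n (f g : ℕ → Carrier) → Σ< n (λ i → f i + g i) ≈ Σ< n f + Σ< n g
  Σ<-+ zero f g = sym (+-identityˡ 0#)
  Σ<-+ (suc n) f g = trans (+-congʳ (Σ<-+ n f g)) (+-interchange _ _ _ _)

  *-distribˡ-Σ< : ∀ n x (f : ℕ → Carrier) → x * Σ< n f ≈ Σ< n (λ i → x * f i)
  *-distribˡ-Σ< zero x f = zeroʳ x
  *-distribˡ-Σ< (suc n) x f = trans (distribˡ x _ _) (+-congʳ (*-distribˡ-Σ< n x f))

  *-distribʳ-Σ< : ∀ n x (f : ℕ → Carrier) → Σ< n f * x ≈ Σ< n (λ i → f i * x)
  *-distribʳ-Σ< zero x f = zeroˡ x
  *-distribʳ-Σ< (suc n) x f = trans (distribʳ x _ _) (+-congʳ (*-distribʳ-Σ< n x f))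

  Σ<-split : ∀ m n (f : ℕ → Carrier) → Σ< (m ℕ.+ n) f ≈ Σ< m f + Σ< n (λ i → f (m ℕ.+ i))
  Σ<-split zero n f = sym (+-identityˡ _)
  Σ<-split (suc m) n f = begin
    Σ< (suc m ℕ.+ n) f                               ≈⟨ Σ<-head (m ℕ.+ n) f ⟩
    f 0 + Σ< (m ℕ.+ n) (f ∘ suc)                      ≈⟨ +-congˡ (Σ<-split m n (f ∘ suc)) ⟩
    f 0 + (Σ< m (f ∘ suc) + Σ< n (λ i → f (suc m ℕ.+ i))) ≈⟨ sym (+-assoc _ _ _) ⟩
    (f 0 + Σ< m (f ∘ suc)) + Σ< n (λ i → f (suc m ℕ.+ i)) ≈⟨ +-congʳ (sym (Σ<-head m f)) ⟩
    Σ< (suc m) f + Σ< n (λ i → f (suc m ℕ.+ i))      ∎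
    where open ≈-Reasoning

  Σ≤-reverse : ∀ k (f : ℕ → Carrier) → Σ≤ k f ≈ Σ≤ k (λ m → f (k ∸ m))
  Σ≤-reverse zero f = refl
  Σ≤-reverse (suc k) f = begin
    Σ≤ k f + f (suc k)                   ≈⟨ +-comm _ _ ⟩
    f (suc k) + Σ≤ k f                   ≈⟨ +-congˡ (Σ≤-reverse k f) ⟩
    f (suc k) + Σ≤ k (λ m → f (k ∸ m))   ≈⟨ sym (Σ<-head (suc k) (λ m → f (suc k ∸ m))) ⟩
    Σ≤ (suc k) (λ m → f (suc k ∸ m))     ∎
    where open ≈-Reasoning

  Σ≤-triangle : ∀ k (f : ℕ → ℕ → Carrier) →
    Σ≤ k (λ q → Σ≤ q (λ m → f m q)) ≈ Σ≤ k (λ m → Σ≤ (k ∸ m) (λ p → f m (m ℕ.+ p)))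
  Σ≤-triangle zero f = refl
  Σ≤-triangle (suc k) f = begin
    Σ≤ (suc k) (λ q → Σ≤ q (λ m → f m q))
      ≈⟨ Σ<-head (suc k) _ ⟩
    Σ≤ 0 (λ m → f m 0) + Σ≤ k (λ q → Σ≤ (suc q) (λ m → f m (suc q)))
      ≈⟨ +-congʳ (+-identityˡ _) ⟩
    f 0 0 + Σ≤ k (λ q → Σ≤ (suc q) (λ m → f m (suc q)))
      ≈⟨ +-congˡ (Σ<-cong (suc k) (λ q → Σ<-head (suc q) _)) ⟩
    f 0 0 + Σ≤ k (λ q → f 0 (suc q) + Σ≤ q (λ m → f (suc m) (suc q)))
      ≈⟨ +-congˡ (Σ<-+ (suc k) _ _) ⟩
    f 0 0 + (Σ≤ k (λ q → f 0 (suc q)) + Σ≤ k (λ q → Σ≤ q (λ m → f (suc m) (suc q))))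
      ≈⟨ sym (+-assoc _ _ _) ⟩
    (f 0 0 + Σ≤ k (λ q → f 0 (suc q))) + Σ≤ k (λ q → Σ≤ q (λ m → f (suc m) (suc q)))
      ≈⟨ +-cong (sym (Σ<-head (suc k) (f 0))) (Σ≤-triangle k (λ m q → f (suc m) (suc q))) ⟩
    Σ≤ (suc k) (f 0) + Σ≤ k (λ m → Σ≤ (k ∸ m) (λ p → f (suc m) (suc m ℕ.+ p)))
      ≈⟨ sym (Σ<-head (suc k) _) ⟩
    Σ≤ (suc k) (λ m → Σ≤ (suc k ∸ m) (λ p → f m (m ℕ.+ p))) ∎
    where open ≈-Reasoning

  -- Power series under the Cauchy product

  infix 4 _≋_
  _≋_ : Series → Series → Set ℓ
  a ≋ b = ∀ k → a k ≈ b k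

  mulS-cong : ∀ {a a′ b b′} → a ≋ a′ → b ≋ b′ → mulS a b ≋ mulS a′ b′
  mulS-cong a≋a′ b≋b′ k = Σ<-cong (suc k) (λ m → *-cong (a≋a′ m) (b≋b′ (k ∸ m)))

  mulS-comm : ∀ a b → mulS a b ≋ mulS b a
  mulS-comm a b k = trans (Σ≤-reverse k _) (Σ<-cong-< (suc k) λ m m≤k →
    trans (*-comm _ _) (reflexive (≡.cong (λ i → b i * a (k ∸ m)) (ℕ.m∸[m∸n]≡n (ℕ.≤-pred m≤k)))))

  mulS-assoc : ∀ a b d → mulS (mulS a b) d ≋ mulS a (mulS b d)
  mulS-assoc a b d k = begin
    Σ≤ k (λ q → Σ≤ q (λ m → a m * b (q ∸ m)) * d (k ∸ q))
      ≈⟨ Σ<-cong (suc k) (λ q → *-distribʳ-Σ< (suc q) _ _) ⟩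
    Σ≤ k (λ q → Σ≤ q (λ m → a m * b (q ∸ m) * d (k ∸ q)))
      ≈⟨ Σ≤-triangle k (λ m q → a m * b (q ∸ m) * d (k ∸ q)) ⟩
    Σ≤ k (λ m → Σ≤ (k ∸ m) (λ p → a m * b (m ℕ.+ p ∸ m) * d (k ∸ (m ℕ.+ p))))
      ≈⟨ Σ<-cong (suc k) (λ m → Σ<-cong (suc (k ∸ m)) (λ p → trans (*-assoc _ _ _) (*-congˡ (*-cong
           (reflexive (≡.cong b (ℕ.m+n∸m≡n m p)))
           (reflexive (≡.cong d (≡.sym (ℕ.∸-+-assoc k m p)))))))) ⟩
    Σ≤ k (λ m → Σ≤ (k ∸ m) (λ p → a m * (b p * d (k ∸ m ∸ p))))
      ≈⟨ Σ<-cong (suc k) (λ m → sym (*-distribˡ-Σ< (suc (k ∸ m)) _ _)) ⟩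
    Σ≤ k (λ m → a m * Σ≤ (k ∸ m) (λ p → b p * d (k ∸ m ∸ p))) ∎
    where open ≈-Reasoning

  mulS-congˡ : ∀ a {b b′} → b ≋ b′ → mulS a b ≋ mulS a b′
  mulS-congˡ a b≋b′ = mulS-cong {a = a} {a′ = a} (λ _ → refl) b≋b′

  mulS-congʳ : ∀ {a a′} b → a ≋ a′ → mulS a b ≋ mulS a′ b
  mulS-congʳ b a≋a′ = mulS-cong {b = b} {b′ = b} a≋a′ (λ _ → refl)

  mulS-identityˡ : ∀ b → mulS oneS b ≋ b
  mulS-identityˡ b k = trans (Σ<-head-only k (λ _ _ → zeroˡ _)) (*-identityˡ (b k))

  mulS-commutativeMonoid : CommutativeMonoid c ℓ
  mulS-commutativeMonoid = record
    { Carrier = Series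
    ; _≈_ = _≋_
    ; _∙_ = mulS
    ; ε = oneS
    ; isCommutativeMonoid = record
      { isMonoid = record
        { isSemigroup = record
          { isMagma = record
            { isEquivalence = record
              { refl = λ _ → refl
              ; sym = λ a≋b k → sym (a≋b k)
              ; trans = λ a≋b b≋d k → trans (a≋b k) (b≋d k)
              }
            ; ∙-cong = mulS-cong
            }
          ; assoc = mulS-assoc
          }
        ; identity = mulS-identityˡ , λ b k → trans (mulS-comm b oneS k) (mulS-identityˡ b k)
        }
      ; comm = mulS-comm
      }
    }

  open CommutativeMonoid mulS-commutativeMonoid using ()
    renaming (refl to ≋-refl; sym to ≋-sym; trans to ≋-trans
             ; identityʳ to mulS-identityʳ; setoid to ≋-setoid)
  open CommutativeSemigroupProperties (CommutativeMonoid.commutativeSemigroup mulS-commutativeMonoid)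
    using () renaming (interchange to mulS-interchange)
  open MonoidProperties (CommutativeMonoid.monoid mulS-commutativeMonoid) using (introʳ; cancelˡ)
  module ≋-Reasoning = SetoidReasoning ≋-setoid

  invUpTo-stable : ∀ a k m → m ≤ k → invUpTo a k m ≡ invS a m
  invUpTo-stable a zero .zero z≤n = ≡.refl
  invUpTo-stable a (suc k) m m≤1+k with ℕ.m≤n⇒m<n∨m≡n m≤1+k
  ... | inj₁ m<1+k rewrite dec-true (m ℕ.≤? k) (ℕ.≤-pred m<1+k) = invUpTo-stable a k m (ℕ.≤-pred m<1+k)
  ... | inj₂ ≡.refl rewrite dec-false (suc k ℕ.≤? k) (ℕ.n≮n k) = ≡.refl

  invS-suc : ∀ a k → invS a (suc k) ≈ - Σ< (suc k) (λ j → a (suc j) * invS a (k ∸ j))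
  invS-suc a k rewrite dec-false (suc k ℕ.≤? k) (ℕ.n≮n k) =
    -‿cong (Σ<-cong (suc k) λ j → *-congˡ (reflexive (invUpTo-stable a k (k ∸ j) (ℕ.m∸n≤m k j))))

  mulS-invS : ∀ a → a 0 ≈ 1# → mulS a (invS a) ≋ oneS
  mulS-invS a a₀≈1 zero = trans (+-identityˡ _) (trans (*-identityʳ _) a₀≈1)
  mulS-invS a a₀≈1 (suc k) = begin
    mulS a (invS a) (suc k)                  ≈⟨ Σ<-head (suc k) _ ⟩
    a 0 * invS a (suc k) + S                 ≈⟨ +-congʳ (trans (*-congʳ a₀≈1) (*-identityˡ _)) ⟩
    invS a (suc k) + S                       ≈⟨ +-congʳ (invS-suc a k) ⟩
    - S + S                                  ≈⟨ -‿inverseˡ S ⟩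
    0#                                       ∎
    where
    open ≈-Reasoning
    S = Σ< (suc k) (λ j → a (suc j) * invS a (k ∸ j))

  invS-unique : ∀ a b → a 0 ≈ 1# → mulS a b ≋ oneS → invS a ≋ b
  invS-unique a b a₀≈1 ab≋1 =
    ≋-trans (introʳ ab≋1 (invS a)) (cancelˡ (≋-trans (mulS-comm (invS a) a) (mulS-invS a a₀≈1)) b)

  -- Generating series of e_j and h_j

  linS : Carrier → Series
  linS d zero = 1#
  linS d (suc zero) = d
  linS d (suc (suc _)) = 0#

  geomS : Carrier → Series
  geomS = pow

  linS-cong : ∀ {d d′} → d ≈ d′ → linS d ≋ linS d′
  linS-cong d≈d′ zero = refl
  linS-cong d≈d′ (suc zero) = d≈d′
  linS-cong d≈d′ (suc (suc _)) = refl

  geomS-cong : ∀ {y y′} → y ≈ y′ → geomS y ≋ geomS y′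
  geomS-cong y≈y′ m = pow-cong m y≈y′

  mulS-linS-zero : ∀ d b → mulS (linS d) b 0 ≈ b 0
  mulS-linS-zero d b = trans (+-identityˡ _) (*-identityˡ _)

  mulS-linS-suc : ∀ d b k → mulS (linS d) b (suc k) ≈ b (suc k) + d * b k
  mulS-linS-suc d b k = begin
    mulS (linS d) b (suc k)                          ≈⟨ Σ<-head (suc k) _ ⟩
    1# * b (suc k) + Σ≤ k (λ m → linS d (suc m) * b (k ∸ m))
      ≈⟨ +-cong (*-identityˡ _) (Σ<-head-only k (λ _ _ → zeroˡ _)) ⟩
    b (suc k) + d * b k                              ∎
    where open ≈-Reasoning

  linS-geomS : ∀ y → mulS (linS (- y)) (geomS y) ≋ oneS
  linS-geomS y zero = mulS-linS-zero (- y) (geomS y)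
  linS-geomS y (suc k) = begin
    mulS (linS (- y)) (geomS y) (suc k)   ≈⟨ mulS-linS-suc (- y) (geomS y) k ⟩
    y * pow y k + - y * pow y k           ≈⟨ sym (distribʳ _ _ _) ⟩
    (y + - y) * pow y k                   ≈⟨ *-congʳ (-‿inverseʳ y) ⟩
    0# * pow y k                          ≈⟨ zeroˡ _ ⟩
    0#                                    ∎
    where open ≈-Reasoning

  truncGeom-≤ : ∀ y {r m} → m ≤ r → truncGeom y r m ≡ pow y m
  truncGeom-≤ y {r} {m} m≤r rewrite dec-true (m ℕ.≤? r) m≤r = ≡.refl

  truncGeom-> : ∀ y {r m} → r < m → truncGeom y r m ≡ 0#
  truncGeom-> y {r} {m} r<m rewrite dec-false (m ℕ.≤? r) (ℕ.<⇒≱ r<m) = ≡.refl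

  prodS-cong : ∀ {n} {f g : Fin n → Series} → (∀ i → f i ≋ g i) → prodS f ≋ prodS g
  prodS-cong {zero} f≋g = ≋-refl
  prodS-cong {suc n} f≋g = mulS-cong (f≋g zero) (prodS-cong (f≋g ∘ suc))

  prodS-mulS : ∀ {n} (f g : Fin n → Series) → prodS (λ i → mulS (f i) (g i)) ≋ mulS (prodS f) (prodS g)
  prodS-mulS {zero} f g = ≋-sym (mulS-identityˡ oneS)
  prodS-mulS {suc n} f g = ≋-trans (mulS-congˡ (mulS (f zero) (g zero)) (prodS-mulS (f ∘ suc) (g ∘ suc)))
    (mulS-interchange (f zero) (g zero) (prodS (f ∘ suc)) (prodS (g ∘ suc)))

  esymS : ∀ {n} → (Fin n → Carrier) → Series
  esymS x j = esym j x

  hsymS : ∀ {n} → (Fin n → Carrier) → Series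
  hsymS x j = hsym j x

  esym-zero : ∀ {n} (x : Fin n → Carrier) → esym 0 x ≡ 1#
  esym-zero {zero} x = ≡.refl
  esym-zero {suc n} x = ≡.refl

  esymS-prodS : ∀ {n} (x : Fin n → Carrier) → esymS x ≋ prodS (linS ∘ x)
  esymS-prodS {zero} x zero = refl
  esymS-prodS {zero} x (suc j) = refl
  esymS-prodS {suc n} x = ≋-trans esymS-step (mulS-congˡ (linS (x zero)) (esymS-prodS (x ∘ suc)))
    where
    esymS-step : esymS x ≋ mulS (linS (x zero)) (esymS (x ∘ suc))
    esymS-step zero = sym (trans (mulS-linS-zero (x zero) (esymS (x ∘ suc))) (reflexive (esym-zero (x ∘ suc))))
    esymS-step (suc j) = sym (mulS-linS-suc (x zero) (esymS (x ∘ suc)) j)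

  hsymS-prodS : ∀ {n} (x : Fin n → Carrier) → hsymS x ≋ prodS (geomS ∘ x)
  hsymS-prodS {zero} x zero = refl
  hsymS-prodS {zero} x (suc j) = refl
  hsymS-prodS {suc n} x = mulS-congˡ (geomS (x zero)) (hsymS-prodS (x ∘ suc))

  esym-scale : ∀ {n} a (y : Fin n → Carrier) j → esym j (λ i → a * y i) ≈ pow a j * esym j y
  esym-scale {zero} a y zero = sym (*-identityˡ 1#)
  esym-scale {zero} a y (suc j) = sym (zeroʳ _)
  esym-scale {suc n} a y zero = sym (*-identityˡ 1#)
  esym-scale {suc n} a y (suc j) = begin
    esym (suc j) (λ i → a * y′ i) + a * y zero * esym j (λ i → a * y′ i)
      ≈⟨ +-cong (esym-scale a y′ (suc j)) (*-congˡ (esym-scale a y′ j)) ⟩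
    pow a (suc j) * esym (suc j) y′ + a * y zero * (pow a j * esym j y′)
      ≈⟨ +-congˡ (*-interchange _ _ _ _) ⟩
    pow a (suc j) * esym (suc j) y′ + pow a (suc j) * (y zero * esym j y′)
      ≈⟨ sym (distribˡ _ _ _) ⟩
    pow a (suc j) * esym (suc j) y ∎
    where
    open ≈-Reasoning
    y′ = y ∘ suc

  hsym-scale : ∀ {n} a (y : Fin n → Carrier) j → hsym j (λ i → a * y i) ≈ pow a j * hsym j y
  hsym-scale {zero} a y zero = sym (*-identityˡ 1#)
  hsym-scale {zero} a y (suc j) = sym (zeroʳ _)
  hsym-scale {suc n} a y j =
    trans (Σ<-cong-< (suc j) term) (sym (*-distribˡ-Σ< (suc j) (pow a j) _))
    where
    open ≈-Reasoning
    y′ = y ∘ suc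
    term : ∀ m → m < suc j →
      pow (a * y zero) m * hsym (j ∸ m) (λ i → a * y′ i) ≈ pow a j * (pow (y zero) m * hsym (j ∸ m) y′)
    term m m<1+j = begin
      pow (a * y zero) m * hsym (j ∸ m) (λ i → a * y′ i)
        ≈⟨ *-cong (pow-distrib-* a (y zero) m) (hsym-scale a y′ (j ∸ m)) ⟩
      pow a m * pow (y zero) m * (pow a (j ∸ m) * hsym (j ∸ m) y′)
        ≈⟨ *-interchange _ _ _ _ ⟩
      pow a m * pow a (j ∸ m) * (pow (y zero) m * hsym (j ∸ m) y′)
        ≈⟨ *-congʳ (sym (pow-split a (ℕ.≤-pred m<1+j))) ⟩
      pow a j * (pow (y zero) m * hsym (j ∸ m) y′) ∎

  -- dilS a is a(t^s); writing s = suc p makes s ∸ 1 reduce to p.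
  module Dilation (p : ℕ) where
    s : ℕ
    s = suc p

    instance
      s-nonZero : NonZero s
      s-nonZero = _

    dilS : Series → Series
    dilS a m = if does (m % s ℕ.≟ 0) then a (m / s) else 0#

    divMod-decomp : ∀ K → K ≡ K / s ℕ.* s ℕ.+ K % s
    divMod-decomp K = ≡.trans (m≡m%n+[m/n]*n K s) (ℕ.+-comm (K % s) (K / s ℕ.* s))

    divMod-elim : ∀ {a} {P : ℕ → Set a} → (∀ q r → r < s → P (q ℕ.* s ℕ.+ r)) → ∀ K → P K
    divMod-elim {P = P} h K = ≡.subst P (≡.sym (divMod-decomp K)) (h (K / s) (K % s) (m%n<n K s))

    dilS-cong : ∀ {a b} → a ≋ b → dilS a ≋ dilS b
    dilS-cong a≋b m with does (m % s ℕ.≟ 0)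
    ... | true = a≋b (m / s)
    ... | false = refl

    dilS-multiple : ∀ a j → dilS a (j ℕ.* s) ≡ a j
    dilS-multiple a j rewrite m*n%n≡0 j s ⦃ s-nonZero ⦄ | m*n/n≡m j s ⦃ s-nonZero ⦄ = ≡.refl

    [j*s+r]%s≡r : ∀ j {r} → r < s → (j ℕ.* s ℕ.+ r) % s ≡ r
    [j*s+r]%s≡r j {r} r<s = ≡.trans (≡.cong (_% s) (ℕ.+-comm (j ℕ.* s) r))
      (≡.trans ([m+kn]%n≡m%n r j s) (m<n⇒m%n≡m r<s))

    dilS-nonmultiple : ∀ a j r → 0 < r → r < s → dilS a (j ℕ.* s ℕ.+ r) ≡ 0#
    dilS-nonmultiple a j (suc r) _ r<s rewrite [j*s+r]%s≡r j r<s = ≡.refl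

    [q*s+r]∸j*s : ∀ {j q} r → j ≤ q → q ℕ.* s ℕ.+ r ∸ j ℕ.* s ≡ (q ∸ j) ℕ.* s ℕ.+ r
    [q*s+r]∸j*s {j} {q} r j≤q =
      ≡.trans (ℕ.+-∸-comm r (ℕ.*-monoˡ-≤ s j≤q)) (≡.cong (ℕ._+ r) (≡.sym (ℕ.*-distribʳ-∸ s q j)))

    SupportedOnMultiples : Series → Set ℓ
    SupportedOnMultiples h = ∀ j r → 0 < r → r < s → h (j ℕ.* s ℕ.+ r) ≈ 0#

    Σ≤-multiples : ∀ q r {h} → r < s → SupportedOnMultiples h →
                   Σ≤ (q ℕ.* s ℕ.+ r) h ≈ Σ≤ q (λ j → h (j ℕ.* s))
    Σ≤-multiples zero r r<s h-supp =
      trans (Σ<-head-only r (λ i i<r → h-supp 0 (suc i) (s≤s z≤n) (ℕ.≤-<-trans i<r r<s))) (sym (+-identityˡ _))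
    Σ≤-multiples (suc q) r {h} r<s h-supp = begin
      Σ< (suc (s ℕ.+ q ℕ.* s ℕ.+ r)) h           ≡⟨ ≡.cong (λ n → Σ< n h) length-split ⟩
      Σ< (s ℕ.+ suc (q ℕ.* s ℕ.+ r)) h           ≈⟨ Σ<-split s _ h ⟩
      Σ< s h + Σ≤ (q ℕ.* s ℕ.+ r) (λ i → h (s ℕ.+ i))
        ≈⟨ +-cong (Σ<-head-only p (λ i i<p → h-supp 0 (suc i) (s≤s z≤n) (s≤s i<p)))
                  (Σ≤-multiples q r r<s shifted-supp) ⟩
      h 0 + Σ≤ q (λ j → h (s ℕ.+ j ℕ.* s))       ≈⟨ sym (Σ<-head (suc q) _) ⟩
      Σ≤ (suc q) (λ j → h (j ℕ.* s))             ∎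
      where
      open ≈-Reasoning
      length-split : suc (s ℕ.+ q ℕ.* s ℕ.+ r) ≡ s ℕ.+ suc (q ℕ.* s ℕ.+ r)
      length-split = ≡.sym (≡.trans (ℕ.+-suc s _) (≡.cong suc (≡.sym (ℕ.+-assoc s _ r))))
      shifted-supp : SupportedOnMultiples (λ i → h (s ℕ.+ i))
      shifted-supp j i 0<i i<s =
        trans (reflexive (≡.cong h (≡.sym (ℕ.+-assoc s (j ℕ.* s) i)))) (h-supp (suc j) i 0<i i<s)

    mulS-dilS : ∀ a b {K} q r → r < s → K ≡ q ℕ.* s ℕ.+ r →
                mulS (dilS a) b K ≈ Σ≤ q (λ j → a j * b (K ∸ j ℕ.* s))
    mulS-dilS a b q r r<s ≡.refl =
      trans (Σ≤-multiples q r r<s supp) (Σ<-cong (suc q) λ j → *-congʳ (reflexive (dilS-multiple a j)))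
      where
      supp : SupportedOnMultiples (λ m → dilS a m * b (q ℕ.* s ℕ.+ r ∸ m))
      supp j i 0<i i<s = trans (*-congʳ (reflexive (dilS-nonmultiple a j i 0<i i<s))) (zeroˡ _)

    mulS-dilS-coeff : ∀ a b k → mulS (dilS a) b k ≈ Σ≤ (k / s) (λ j → a j * b (k ∸ s ℕ.* j))
    mulS-dilS-coeff a b k = trans (mulS-dilS a b (k / s) (k % s) (m%n<n k s) (divMod-decomp k))
      (Σ<-cong (suc (k / s)) λ j → reflexive (≡.cong (λ t → a j * b (k ∸ t)) (ℕ.*-comm j s)))

    dilS-mulS : ∀ a b → dilS (mulS a b) ≋ mulS (dilS a) (dilS b)
    dilS-mulS a b = divMod-elim coeff
      where
      coeff : ∀ q r → r < s → dilS (mulS a b) (q ℕ.* s ℕ.+ r) ≈ mulS (dilS a) (dilS b) (q ℕ.* s ℕ.+ r)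
      coeff q zero r<s = begin
        dilS (mulS a b) (q ℕ.* s ℕ.+ 0)        ≡⟨ ≡.cong (dilS (mulS a b)) (ℕ.+-identityʳ (q ℕ.* s)) ⟩
        dilS (mulS a b) (q ℕ.* s)              ≡⟨ dilS-multiple (mulS a b) q ⟩
        Σ≤ q (λ j → a j * b (q ∸ j))
          ≈⟨ Σ<-cong-< (suc q) (λ j j≤q → *-congˡ (reflexive (≡.sym (≡.trans
               (≡.cong (dilS b) (≡.trans ([q*s+r]∸j*s 0 (ℕ.≤-pred j≤q)) (ℕ.+-identityʳ ((q ∸ j) ℕ.* s))))
               (dilS-multiple b (q ∸ j)))))) ⟩
        Σ≤ q (λ j → a j * dilS b (q ℕ.* s ℕ.+ 0 ∸ j ℕ.* s)) ≈⟨ sym (mulS-dilS a (dilS b) q 0 r<s ≡.refl) ⟩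
        mulS (dilS a) (dilS b) (q ℕ.* s ℕ.+ 0) ∎
        where open ≈-Reasoning
      coeff q (suc r) r<s = begin
        dilS (mulS a b) (q ℕ.* s ℕ.+ suc r)    ≡⟨ dilS-nonmultiple (mulS a b) q (suc r) (s≤s z≤n) r<s ⟩
        0#                                     ≈⟨ sym (Σ<-zero (suc q) λ j j≤q → trans
             (*-congˡ (reflexive (≡.trans (≡.cong (dilS b) ([q*s+r]∸j*s (suc r) (ℕ.≤-pred j≤q)))
                                          (dilS-nonmultiple b (q ∸ j) (suc r) (s≤s z≤n) r<s))))
             (zeroʳ _)) ⟩
        Σ≤ q (λ j → a j * dilS b (q ℕ.* s ℕ.+ suc r ∸ j ℕ.* s)) ≈⟨ sym (mulS-dilS a (dilS b) q (suc r) r<s ≡.refl) ⟩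
        mulS (dilS a) (dilS b) (q ℕ.* s ℕ.+ suc r) ∎
        where open ≈-Reasoning

    dilS-oneS : dilS oneS ≋ oneS
    dilS-oneS = divMod-elim coeff
      where
      coeff : ∀ q r → r < s → dilS oneS (q ℕ.* s ℕ.+ r) ≈ oneS (q ℕ.* s ℕ.+ r)
      coeff zero zero _ = refl
      coeff (suc q) zero _ =
        reflexive (≡.trans (≡.cong (dilS oneS) (ℕ.+-identityʳ (suc q ℕ.* s))) (dilS-multiple oneS (suc q)))
      coeff q (suc r) r<s = reflexive (≡.trans (dilS-nonmultiple oneS q (suc r) (s≤s z≤n) r<s)
                                                (≡.cong oneS (≡.sym (ℕ.+-suc (q ℕ.* s) r))))

    prodS-dilS-mulS : ∀ {n} (f g : Fin n → Series) →
                      prodS (λ i → mulS (dilS (f i)) (g i)) ≋ mulS (dilS (prodS f)) (prodS g)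
    prodS-dilS-mulS f g = ≋-trans (prodS-mulS (dilS ∘ f) g) (mulS-congʳ (prodS g) (≋-sym (dilS-prodS f)))
      where
      dilS-prodS : ∀ {n} (f : Fin n → Series) → dilS (prodS f) ≋ prodS (dilS ∘ f)
      dilS-prodS {zero} f = dilS-oneS
      dilS-prodS {suc n} f = ≋-trans (dilS-mulS (f zero) (prodS (f ∘ suc)))
                                     (mulS-congˡ (dilS (f zero)) (dilS-prodS (f ∘ suc)))

    truncGeom-factor : ∀ y → truncGeom y p ≋ mulS (dilS (linS (- pow y s))) (geomS y)
    truncGeom-factor y = divMod-elim coeff
      where
      L = linS (- pow y s)
      coeff : ∀ q r → r < s → truncGeom y p (q ℕ.* s ℕ.+ r) ≈ mulS (dilS L) (geomS y) (q ℕ.* s ℕ.+ r)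
      coeff zero r r<s = begin
        truncGeom y p r                     ≡⟨ truncGeom-≤ y (ℕ.≤-pred r<s) ⟩
        pow y r                             ≈⟨ sym (trans (+-identityˡ _) (*-identityˡ _)) ⟩
        Σ≤ 0 (λ j → L j * pow y (r ∸ j ℕ.* s)) ≈⟨ sym (mulS-dilS L (geomS y) 0 r r<s ≡.refl) ⟩
        mulS (dilS L) (geomS y) r           ∎
        where open ≈-Reasoning
      coeff (suc q) r r<s = begin
        truncGeom y p K                     ≡⟨ truncGeom-> y s≤K ⟩
        0#                                  ≈⟨ sym (-‿inverseʳ _) ⟩
        pow y s * pow y (K ∸ s) + - (pow y s * pow y (K ∸ s))
          ≈⟨ +-cong (sym (trans (*-identityˡ _) (pow-split y s≤K)))
                    (trans (-‿distribˡ-* _ _) (*-congˡ (reflexive (≡.cong (λ t → pow y (K ∸ t)) (≡.sym (ℕ.*-identityˡ s)))))) ⟩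
        F 0 + F 1                           ≈⟨ +-congˡ (sym (Σ<-head-only q λ _ _ → zeroˡ _)) ⟩
        F 0 + Σ≤ q (F ∘ suc)                ≈⟨ sym (Σ<-head (suc q) F) ⟩
        Σ≤ (suc q) F                        ≈⟨ sym (mulS-dilS L (geomS y) (suc q) r r<s ≡.refl) ⟩
        mulS (dilS L) (geomS y) K           ∎
        where
        open ≈-Reasoning
        K = suc q ℕ.* s ℕ.+ r
        F = λ j → L j * pow y (K ∸ j ℕ.* s)
        s≤K : s ≤ K
        s≤K = ℕ.≤-trans (ℕ.m≤m+n s (q ℕ.* s)) (ℕ.m≤m+n _ r)

    invS-truncGeom : ∀ y → invS (truncGeom y p) ≋ mulS (dilS (geomS (pow y s))) (linS (- y))
    invS-truncGeom y = invS-unique _ _ (reflexive (truncGeom-≤ y {p} z≤n)) (begin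
      mulS (truncGeom y p) (mulS (dilS G) (linS (- y)))
        ≈⟨ mulS-congʳ (mulS (dilS G) (linS (- y))) (truncGeom-factor y) ⟩
      mulS (mulS (dilS L) (geomS y)) (mulS (dilS G) (linS (- y)))
        ≈⟨ mulS-interchange (dilS L) (geomS y) (dilS G) (linS (- y)) ⟩
      mulS (mulS (dilS L) (dilS G)) (mulS (geomS y) (linS (- y)))
        ≈⟨ mulS-cong (≋-sym (dilS-mulS L G)) (≋-trans (mulS-comm (geomS y) (linS (- y))) (linS-geomS y)) ⟩
      mulS (dilS (mulS L G)) oneS           ≈⟨ mulS-identityʳ (dilS (mulS L G)) ⟩
      dilS (mulS L G)                       ≈⟨ dilS-cong (linS-geomS (pow y s)) ⟩
      dilS oneS                             ≈⟨ dilS-oneS ⟩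
      oneS                                  ∎)
      where
      open ≋-Reasoning
      L = linS (- pow y s)
      G = geomS (pow y s)

    Er-dilS : ∀ {n} (x : Fin n → Carrier) →
              Er p x ≋ mulS (dilS (esymS (λ i → - 1# * pow (x i) s))) (hsymS x)
    Er-dilS x = begin
      prodS (λ i → truncGeom (x i) p)
        ≈⟨ prodS-cong (λ i → ≋-trans (truncGeom-factor (x i))
             (mulS-congʳ (geomS (x i)) (dilS-cong (linS-cong (sym (-1*x≈-x _)))))) ⟩
      prodS (λ i → mulS (dilS (linS (ys i))) (geomS (x i)))  ≈⟨ prodS-dilS-mulS (linS ∘ ys) (geomS ∘ x) ⟩
      mulS (dilS (prodS (linS ∘ ys))) (prodS (geomS ∘ x))
        ≈⟨ mulS-cong (dilS-cong (≋-sym (esymS-prodS ys))) (≋-sym (hsymS-prodS x)) ⟩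
      mulS (dilS (esymS ys)) (hsymS x)                         ∎
      where
      open ≋-Reasoning
      ys = λ i → - 1# * pow (x i) s

    Hr-dilS : ∀ {n} (x : Fin n → Carrier) →
              Hr p x ≋ mulS (dilS (hsymS (λ i → pow (- 1#) s * pow (x i) s))) (esymS x)
    Hr-dilS x = begin
      prodS (λ i → invS (truncGeom (- x i) p))
        ≈⟨ prodS-cong (λ i → ≋-trans (invS-truncGeom (- x i))
             (mulS-cong (dilS-cong (geomS-cong (pow-neg (x i)))) (linS-cong (-‿involutive (x i))))) ⟩
      prodS (λ i → mulS (dilS (geomS (ys i))) (linS (x i)))  ≈⟨ prodS-dilS-mulS (geomS ∘ ys) (linS ∘ x) ⟩
      mulS (dilS (prodS (geomS ∘ ys))) (prodS (linS ∘ x))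
        ≈⟨ mulS-cong (dilS-cong (≋-sym (hsymS-prodS ys))) (≋-sym (esymS-prodS x)) ⟩
      mulS (dilS (hsymS ys)) (esymS x)                         ∎
      where
      open ≋-Reasoning
      ys = λ i → pow (- 1#) s * pow (x i) s
      pow-neg : ∀ z → pow (- z) s ≈ pow (- 1#) s * pow z s
      pow-neg z = trans (pow-cong s (sym (-1*x≈-x z))) (pow-distrib-* (- 1#) z s)

    Hr-coeff : ∀ {n} (x : Fin n → Carrier) k →
      Hr p x k ≈ Σ≤ (k / s) (λ j → pow (- 1#) (s ℕ.* j) * hsym j (powVars s x) * esym (k ∸ s ℕ.* j) x)
    Hr-coeff x k = begin
      Hr p x k                                             ≈⟨ Hr-dilS x k ⟩
      mulS (dilS (hsymS ys)) (esymS x) k                   ≈⟨ mulS-dilS-coeff (hsymS ys) (esymS x) k ⟩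
      Σ≤ (k / s) (λ j → hsym j ys * esym (k ∸ s ℕ.* j) x)
        ≈⟨ Σ<-cong (suc (k / s)) (λ j → *-congʳ (trans (hsym-scale σ (powVars s x) j)
                                                          (*-congʳ (sym (pow-* (- 1#) s j))))) ⟩
      Σ≤ (k / s) (λ j → pow (- 1#) (s ℕ.* j) * hsym j (powVars s x) * esym (k ∸ s ℕ.* j) x) ∎
      where
      open ≈-Reasoning
      σ = pow (- 1#) s
      ys = λ i → σ * pow (x i) s

    Er-coeff : ∀ {n} (x : Fin n → Carrier) k →
      Er p x k ≈ Σ≤ (k / s) (λ j → pow (- 1#) j * esym j (powVars s x) * hsym (k ∸ s ℕ.* j) x)
    Er-coeff x k = begin
      Er p x k                                             ≈⟨ Er-dilS x k ⟩
      mulS (dilS (esymS ys)) (hsymS x) k                   ≈⟨ mulS-dilS-coeff (esymS ys) (hsymS x) k ⟩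
      Σ≤ (k / s) (λ j → esym j ys * hsym (k ∸ s ℕ.* j) x)
        ≈⟨ Σ<-cong (suc (k / s)) (λ j → *-congʳ (esym-scale (- 1#) (powVars s x) j)) ⟩
      Σ≤ (k / s) (λ j → pow (- 1#) j * esym j (powVars s x) * hsym (k ∸ s ℕ.* j) x) ∎
      where
      open ≈-Reasoning
      ys = λ i → - 1# * pow (x i) s

theorem3p3 : ∀ {c ℓ} (R : CommutativeRing c ℓ) → let open CommutativeRing R in let open Sym R in
    (k n s : ℕ) → .{{_ : NonZero k}} → .{{_ : NonZero n}} → .{{_ : NonZero s}} → (x : Fin n → Carrier) →
      (Hr (s ∸ 1) x k ≈ Σ≤ (k / s) (λ j → pow (- 1#) (s ℕ.* j) * hsym j (powVars s x) * esym (k ∸ s ℕ.* j) x))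
      × (Er (s ∸ 1) x k ≈ Σ≤ (k / s) (λ j → pow (- 1#) j * esym j (powVars s x) * hsym (k ∸ s ℕ.* j) x))
theorem3p3 R k n (suc p) x = Hr-coeff x k , Er-coeff x k
  where open PowerSeries R using (module Dilation)
        open Dilation p
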